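{- Let $a<b$ be positive odd integers with $a\neq1$. Then there is no infinite smooth word over $\{a,b\}$ that is also an infinite Lyndon word.
   Context: Words over $\{a,b\}$ are compared lexicographically with $a<b$. For a word $w$ over $\{a,b\}$ written as maximal blocks $\alpha_0^{i_0}\alpha_1^{i_1}\cdots$ ($\alpha_{k+1}\ne\alpha_k$, $i_k\ge1$), $\Delta(w)=i_0i_1\cdots$. An infinite word $w\in\{a,b\}^\omega$ is smooth if $\Delta^k(w)\in\{a,b\}^\omega$ for all $k\ge0$. An infinite Lyndon word is an infinite word strictly smaller than each of its proper suffixes. -}

module Defs where

open import Data.Nat using (ℕ; zero; suc; _+_; _*_; _<_; _≤_)
open import Data.Product using (Σ; ∃; _×_; _,_)
open import Data.Sum using (_⊎_)
open import Relation.Binary.PropositionalEquality using (_≡_; _≢_)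

Word : Set
Word = ℕ → ℕ

-- Odd natural number (odd naturals are automatically positive).
Odd : ℕ → Set
Odd n = ∃ λ k → n ≡ suc (2 * k)

OverAB : ℕ → ℕ → Word → Set
OverAB a b w = ∀ n → (w n ≡ a) ⊎ (w n ≡ b)

-- partial sums: start k v = v 0 + ... + v (k-1), the start of the k-th block
start : Word → ℕ → ℕ
start v zero    = 0
start v (suc k) = start v k + v k

-- IsΔ w v : v = Δ(w) and Δ(w) is infinite, i.e. w consists of the infinite
-- sequence of maximal blocks of lengths v 0, v 1, v 2, ...
IsΔ : Word → Word → Set
IsΔ w v = ∀ k → (1 ≤ v k)
               × (∀ j → j < v k → w (start v k + j) ≡ w (start v k))
               × (w (start v (suc k)) ≢ w (start v k))

Smooth : ℕ → ℕ → Word → Set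
Smooth a b w = Σ (ℕ → Word) λ W →
  (∀ n → W 0 n ≡ w n) × (∀ k → IsΔ (W k) (W (suc k))) × (∀ k → OverAB a b (W k))

_<lex_ : Word → Word → Set
u <lex v = ∃ λ m → (∀ j → j < m → u j ≡ v j) × (u m < v m)

Lyndon : Word → Set
Lyndon w = ∀ i → 1 ≤ i → w <lex (λ n → w (i + n))

-- Write w = c₀^{v₀} c₁^{v₁} ⋯ with v = Δ(w) and μ = Δ(v). If the suffix of w
-- starting at block k > 0 has c_k = c_0 and the same block lengths as w for m
-- blocks, the two words agree until the shorter of the two m-th blocks ends;
-- the Lyndon property then forces c_m = a if the suffix's block is the
-- shorter one, and c_m = b otherwise. Since a < b, w begins with a, and
-- c_k = c_0 exactly for even k. The blocks of v have odd lengths μ_i ≥ 3.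
-- If v₀ = a, the suffix at the even block μ₀ + 1 starts with a b-block
-- against w's a-block, forcing c_0 = b. If v₀ = b and μ₀ = l + 2, then
-- v₀ = … = v_{l+1} = b and v_{l+2} = a, so the suffix at block 2 matches w
-- for l blocks and then has the shorter block, forcing c_l = a although l
-- is odd.
module Submission where

open import Defs
open import Data.Nat using (ℕ; zero; suc; _+_; _*_; _<_; _≤_; _<?_; z≤n; s≤s)
open import Data.Nat.Properties
open import Data.Product using (∃; ∃₂; _×_; _,_; proj₁; proj₂)
open import Data.Sum using (_⊎_; inj₁; inj₂)
open import Data.Empty using (⊥; ⊥-elim)
open import Relation.Nullary using (¬_; yes; no)
open import Relation.Binary.Definitions using (tri<; tri≈; tri>)
open import Relation.Binary.PropositionalEquality

start-shift : ∀ (v : Word) {k m} → (∀ j → j < m → v (k + j) ≡ v j) →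
              ∀ j → j ≤ m → start v (k + j) ≡ start v k + start v j
start-shift v {k} _ zero _ = trans (cong (start v) (+-identityʳ k)) (sym (+-identityʳ _))
start-shift v {k} same (suc j) j<m = begin
  start v (k + suc j)                    ≡⟨ cong (start v) (+-suc k j) ⟩
  start v (k + j) + v (k + j)            ≡⟨ cong₂ _+_ (start-shift v same j (<⇒≤ j<m)) (same j j<m) ⟩
  start v k + start v j + v j            ≡⟨ +-assoc (start v k) _ _ ⟩
  start v k + (start v j + v j)          ∎
  where open ≡-Reasoning

start-shift-+ : ∀ (v : Word) {k m} → (∀ j → j < m → v (k + j) ≡ v j) →
                ∀ {j} r → j ≤ m → start v k + (start v j + r) ≡ start v (k + j) + r
start-shift-+ v {k} same {j} r j≤m =
  trans (sym (+-assoc (start v k) (start v j) r)) (cong (_+ r) (sym (start-shift v same j j≤m)))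

start-decompose : ∀ (v : Word) m q → q < start v m →
                  ∃₂ λ j r → j < m × r < v j × q ≡ start v j + r
start-decompose v (suc m) q q<s with q <? start v m
... | yes q<s′ = let j , r , j<m , r<v , q≡ = start-decompose v m q q<s′
                 in j , r , m<n⇒m<1+n j<m , r<v , q≡
... | no q≮s′  = let r , s+r≡q = m≤n⇒∃[o]m+o≡n (≮⇒≥ q≮s′)
                 in m , r , ≤-refl
                  , +-cancelˡ-< (start v m) r (v m) (subst (_< start v (suc m)) (sym s+r≡q) q<s)
                  , sym s+r≡q

Lyndon-cong : ∀ {u w : Word} → (∀ n → u n ≡ w n) → Lyndon w → Lyndon u
Lyndon-cong {u} {w} u≗w ly i i≥1 =
  let m , agree , lt = ly i i≥1
  in m , (λ j j<m → trans (u≗w j) (trans (agree j j<m) (sym (u≗w (i + j)))))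
       , subst₂ _<_ (sym (u≗w m)) (sym (u≗w (i + m))) lt

Lyndon-prefix-≤ : ∀ {w : Word} → Lyndon w → ∀ {i p} → 1 ≤ i →
                  (∀ q → q < p → w (i + q) ≡ w q) → w p ≤ w (i + p)
Lyndon-prefix-≤ ly {i} {p} i≥1 agree with ly i i≥1
... | m , agree′ , w<w with <-cmp m p
... | tri< m<p _ _ = ⊥-elim (<-irrefl (sym (agree m m<p)) w<w)
... | tri≈ _ refl _ = <⇒≤ w<w
... | tri> _ _ p<m = ≤-reflexive (agree′ p p<m)

module TwoLetters {a b : ℕ} (a<b : a < b) where

  IsAB : ℕ → Set
  IsAB x = x ≡ a ⊎ x ≡ b

  ≢a⇒≡b : ∀ {x} → IsAB x → x ≢ a → x ≡ b
  ≢a⇒≡b (inj₁ x≡a) x≢a = ⊥-elim (x≢a x≡a)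
  ≢a⇒≡b (inj₂ x≡b) _   = x≡b

  ≢b⇒≡a : ∀ {x} → IsAB x → x ≢ b → x ≡ a
  ≢b⇒≡a (inj₁ x≡a) _   = x≡a
  ≢b⇒≡a (inj₂ x≡b) x≢b = ⊥-elim (x≢b x≡b)

  ≢-same⇒≡ : ∀ {x y z} → IsAB x → IsAB y → IsAB z → x ≢ z → y ≢ z → x ≡ y
  ≢-same⇒≡ (inj₁ refl) (inj₁ refl) _           _   _   = refl
  ≢-same⇒≡ (inj₂ refl) (inj₂ refl) _           _   _   = refl
  ≢-same⇒≡ (inj₁ refl) (inj₂ refl) (inj₁ refl) x≢z _   = ⊥-elim (x≢z refl)
  ≢-same⇒≡ (inj₁ refl) (inj₂ refl) (inj₂ refl) _   y≢z = ⊥-elim (y≢z refl)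
  ≢-same⇒≡ (inj₂ refl) (inj₁ refl) (inj₁ refl) _   y≢z = ⊥-elim (y≢z refl)
  ≢-same⇒≡ (inj₂ refl) (inj₁ refl) (inj₂ refl) x≢z _   = ⊥-elim (x≢z refl)

  <⇒≡a×≡b : ∀ {x y} → IsAB x → IsAB y → x < y → x ≡ a × y ≡ b
  <⇒≡a×≡b (inj₁ refl) (inj₂ refl) _   = refl , refl
  <⇒≡a×≡b (inj₁ refl) (inj₁ refl) x<y = ⊥-elim (<-irrefl refl x<y)
  <⇒≡a×≡b (inj₂ refl) (inj₂ refl) x<y = ⊥-elim (<-irrefl refl x<y)
  <⇒≡a×≡b (inj₂ refl) (inj₁ refl) x<y = ⊥-elim (<-asym a<b x<y)

module Blocks (w v : Word) (Δ : IsΔ w v) where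

  letter : ℕ → ℕ
  letter k = w (start v k)

  block-letter : ∀ {k r} → r < v k → w (start v k + r) ≡ letter k
  block-letter {k} {r} = proj₁ (proj₂ (Δ k)) r

  letter-suc-≢ : ∀ k → letter (suc k) ≢ letter k
  letter-suc-≢ k = proj₂ (proj₂ (Δ k))

  start-pos : ∀ {k} → 1 ≤ k → 1 ≤ start v k
  start-pos {suc k} _ = ≤-trans (proj₁ (Δ k)) (m≤n+m (v k) (start v k))

module TwoLetterBlocks {a b : ℕ} (a<b : a < b) (w v : Word)
                       (over : OverAB a b w) (Δ : IsΔ w v) where
  open TwoLetters a<b
  open Blocks w v Δ

  letter-shift : ∀ k k′ → letter k ≡ letter k′ → ∀ j → letter (k + j) ≡ letter (k′ + j)
  letter-shift k k′ ℓ≡ zero = subst₂ (λ x y → letter x ≡ letter y)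
                                (sym (+-identityʳ k)) (sym (+-identityʳ k′)) ℓ≡
  letter-shift k k′ ℓ≡ (suc j) = subst₂ (λ x y → letter x ≡ letter y)
    (sym (+-suc k j)) (sym (+-suc k′ j))
    (≢-same⇒≡ (over _) (over _) (over _)
      (subst (letter (suc (k + j)) ≢_) (letter-shift k k′ ℓ≡ j) (letter-suc-≢ (k + j)))
      (letter-suc-≢ (k′ + j)))

  letter-even : ∀ t → letter (2 * t) ≡ letter 0
  letter-even zero = refl
  letter-even (suc t) = begin
    letter (2 * suc t)   ≡⟨ cong letter (*-suc 2 t) ⟩
    letter (2 + 2 * t)   ≡⟨ letter-shift 2 0 ℓ₂≡ℓ₀ (2 * t) ⟩
    letter (2 * t)       ≡⟨ letter-even t ⟩
    letter 0             ∎
    where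
    open ≡-Reasoning
    ℓ₂≡ℓ₀ : letter 2 ≡ letter 0
    ℓ₂≡ℓ₀ = ≢-same⇒≡ (over _) (over _) (over _) (letter-suc-≢ 1) (≢-sym (letter-suc-≢ 0))

  letter-odd : ∀ {n} → Odd n → letter n ≡ letter 1
  letter-odd (t , refl) = subst (λ n → letter n ≡ letter 1) (+-comm (2 * t) 1)
                            (letter-shift (2 * t) 0 (letter-even t) 1)

  letter-suc-odd : ∀ {n} → Odd n → letter (suc n) ≡ letter 0
  letter-suc-odd (t , refl) = subst (λ n → letter n ≡ letter 0) (*-suc 2 t) (letter-even (suc t))

  shifted-block-agrees : ∀ {k m} → letter k ≡ letter 0 → (∀ j → j < m → v (k + j) ≡ v j) →
                         ∀ {j r} → j ≤ m → r < v j → r < v (k + j) →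
                         w (start v k + (start v j + r)) ≡ w (start v j + r)
  shifted-block-agrees {k} ℓk≡ℓ0 same {j} {r} j≤m r<vj r<vkj = begin
    w (start v k + (start v j + r))  ≡⟨ cong w (start-shift-+ v same r j≤m) ⟩
    w (start v (k + j) + r)          ≡⟨ block-letter r<vkj ⟩
    letter (k + j)                   ≡⟨ letter-shift k 0 ℓk≡ℓ0 j ⟩
    letter j                         ≡⟨ block-letter r<vj ⟨
    w (start v j + r)                ∎
    where open ≡-Reasoning

  prefix-repeats : ∀ {k m n} → letter k ≡ letter 0 → (∀ j → j < m → v (k + j) ≡ v j) →
                   n ≤ v m → n ≤ v (k + m) →
                   ∀ q → q < start v m + n → w (start v k + q) ≡ w q
  prefix-repeats {k} {m} {n} ℓk≡ℓ0 same n≤vm n≤vkm q q<s+n with q <? start v m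
  ... | yes q<s =
    let j , r , j<m , r<vj , q≡ = start-decompose v m q q<s
    in subst (λ q → w (start v k + q) ≡ w q) (sym q≡)
         (shifted-block-agrees ℓk≡ℓ0 same (<⇒≤ j<m) r<vj (subst (r <_) (sym (same j j<m)) r<vj))
  ... | no q≮s =
    let r , s+r≡q = m≤n⇒∃[o]m+o≡n (≮⇒≥ q≮s)
        r<n = +-cancelˡ-< (start v m) r n (subst (_< start v m + n) (sym s+r≡q) q<s+n)
    in subst (λ q → w (start v k + q) ≡ w q) s+r≡q
         (shifted-block-agrees ℓk≡ℓ0 same ≤-refl (<-≤-trans r<n n≤vm) (<-≤-trans r<n n≤vkm))

  Lyndon-first-letter : Lyndon w → letter 0 ≡ a
  Lyndon-first-letter ly =
    proj₁ (<⇒≡a×≡b (over _) (over _) (≤∧≢⇒< w₀≤ℓ₁ (≢-sym (letter-suc-≢ 0))))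
    where
    w₀≤ℓ₁ : w 0 ≤ letter 1
    w₀≤ℓ₁ = subst (λ n → w 0 ≤ w n) (+-identityʳ (v 0))
              (Lyndon-prefix-≤ ly (start-pos {1} (s≤s z≤n)) (λ q ()))

  Lyndon-shorter-block : Lyndon w → ∀ {k m} → 1 ≤ k → letter k ≡ letter 0 →
                         (∀ j → j < m → v (k + j) ≡ v j) → v (k + m) < v m → letter m ≡ a
  Lyndon-shorter-block ly {k} {m} k≥1 ℓk≡ℓ0 same shorter =
    proj₁ (<⇒≡a×≡b (over _) (over _) (≤∧≢⇒< ℓm≤ℓ′ ℓm≢ℓ′))
    where
    ℓm≤ℓ′ : letter m ≤ letter (suc (k + m))
    ℓm≤ℓ′ = subst₂ _≤_ (block-letter shorter) (cong w (start-shift-+ v same (v (k + m)) ≤-refl))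
              (Lyndon-prefix-≤ ly (start-pos k≥1) (prefix-repeats ℓk≡ℓ0 same (<⇒≤ shorter) ≤-refl))
    ℓm≢ℓ′ : letter m ≢ letter (suc (k + m))
    ℓm≢ℓ′ ℓm≡ℓ′ = letter-suc-≢ (k + m) (trans (sym ℓm≡ℓ′) (sym (letter-shift k 0 ℓk≡ℓ0 m)))

  Lyndon-longer-block : Lyndon w → ∀ {k m} → 1 ≤ k → letter k ≡ letter 0 →
                        (∀ j → j < m → v (k + j) ≡ v j) → v m < v (k + m) → letter m ≡ b
  Lyndon-longer-block ly {k} {m} k≥1 ℓk≡ℓ0 same longer =
    proj₂ (<⇒≡a×≡b (over _) (over _) (≤∧≢⇒< ℓ′≤ℓm (letter-suc-≢ m)))
    where
    ℓ′≤ℓm : letter (suc m) ≤ letter m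
    ℓ′≤ℓm = subst (letter (suc m) ≤_)
              (trans (cong w (start-shift-+ v same (v m) ≤-refl))
                     (trans (block-letter longer) (letter-shift k 0 ℓk≡ℓ0 m)))
              (Lyndon-prefix-≤ ly (start-pos k≥1) (prefix-repeats ℓk≡ℓ0 same ≤-refl (<⇒≤ longer)))

Odd⇒1≤ : ∀ {n} → Odd n → 1 ≤ n
Odd⇒1≤ (_ , refl) = s≤s z≤n

Odd⇒2+Odd : ∀ {n} → Odd n → 1 < n → ∃ λ l → Odd l × n ≡ 2 + l
Odd⇒2+Odd (zero , refl)  (s≤s ())
Odd⇒2+Odd (suc t , refl) _ = suc (2 * t) , (t , refl) , cong suc (*-suc 2 t)

module SmoothLyndon {a b : ℕ} (odd-a : Odd a) (odd-b : Odd b) (a<b : a < b) (a≢1 : a ≢ 1)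
                    (w v μ : Word) (over-w : OverAB a b w) (over-v : OverAB a b v)
                    (over-μ : OverAB a b μ) (Δw : IsΔ w v) (Δv : IsΔ v μ) (ly : Lyndon w) where
  open TwoLetters a<b
  open Blocks w v Δw
  open TwoLetterBlocks a<b w v over-w Δw
  module V = Blocks v μ Δv

  Odd-letter : ∀ {x} → IsAB x → Odd x
  Odd-letter (inj₁ refl) = odd-a
  Odd-letter (inj₂ refl) = odd-b

  1<letter : ∀ {x} → IsAB x → 1 < x
  1<letter (inj₁ refl) = ≤∧≢⇒< (Odd⇒1≤ odd-a) (≢-sym a≢1)
  1<letter (inj₂ refl) = <-trans (1<letter (inj₁ refl)) a<b

  ℓ₀≡a : letter 0 ≡ a
  ℓ₀≡a = Lyndon-first-letter ly

  v₀≡b : v 0 ≡ b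
  v₀≡b = ≢a⇒≡b (over-v 0) v₀≢a
    where
    v₀≢a : v 0 ≢ a
    v₀≢a v₀≡a = <-irrefl (trans (sym ℓ₀≡a) ℓ₀≡b) a<b
      where
      L = μ 0
      vL≡b : v L ≡ b
      vL≡b = ≢a⇒≡b (over-v L) (subst (v L ≢_) v₀≡a (V.letter-suc-≢ 0))
      vL+1≡vL : v (suc L) ≡ v L
      vL+1≡vL = trans (cong v (+-comm 1 L)) (V.block-letter {1} {1} (1<letter (over-μ 1)))
      longer : v 0 < v (suc L + 0)
      longer = subst₂ _<_ (sym v₀≡a)
                 (sym (trans (cong v (+-identityʳ (suc L))) (trans vL+1≡vL vL≡b))) a<b
      ℓ₀≡b : letter 0 ≡ b
      ℓ₀≡b = Lyndon-longer-block ly {suc L} {0} (s≤s z≤n)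
               (letter-suc-odd (Odd-letter (over-μ 0))) (λ _ ()) longer

  absurd : ⊥
  absurd with Odd⇒2+Odd (Odd-letter (over-μ 0)) (1<letter (over-μ 0))
  ... | l , odd-l , μ₀≡2+l = letter-suc-≢ 0 (begin
    letter 1  ≡⟨ letter-odd odd-l ⟨
    letter l  ≡⟨ ℓl≡a ⟩
    a         ≡⟨ ℓ₀≡a ⟨
    letter 0  ∎)
    where
    open ≡-Reasoning
    v-prefix : ∀ j → j < 2 + l → v j ≡ b
    v-prefix j j<2+l = trans (V.block-letter {0} (subst (j <_) (sym μ₀≡2+l) j<2+l)) v₀≡b
    v₂₊ₗ≡a : v (2 + l) ≡ a
    v₂₊ₗ≡a = subst (λ n → v n ≡ a) μ₀≡2+l
               (≢b⇒≡a (over-v _) (subst (v (μ 0) ≢_) v₀≡b (V.letter-suc-≢ 0)))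
    same : ∀ j → j < l → v (2 + j) ≡ v j
    same j j<l = trans (v-prefix (2 + j) (s≤s (s≤s j<l)))
                       (sym (v-prefix j (≤-trans j<l (m≤n+m l 2))))
    shorter : v (2 + l) < v l
    shorter = subst₂ _<_ (sym v₂₊ₗ≡a) (sym (v-prefix l (n≤1+n (suc l)))) a<b
    ℓl≡a : letter l ≡ a
    ℓl≡a = Lyndon-shorter-block ly {2} {l} (s≤s z≤n) (letter-even 1) same shorter

theorem22 : (a b : ℕ) → Odd a → Odd b → a < b → a ≢ 1 →
    ¬ (∃ λ w → OverAB a b w × Smooth a b w × Lyndon w)
theorem22 a b odd-a odd-b a<b a≢1 (w , _ , (W , W₀≗w , Δ , over) , ly) =
  SmoothLyndon.absurd odd-a odd-b a<b a≢1 (W 0) (W 1) (W 2) (over 0) (over 1) (over 2)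
    (Δ 0) (Δ 1) (Lyndon-cong W₀≗w ly)
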